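{- If $\vdash G\parallel\mathcal M$ (i.e. $G\parallel\mathcal M$ is balanced) and $G\parallel\mathcal M\xrightarrow{\beta}G'\parallel\mathcal M'$, then $\vdash G'\parallel\mathcal M'$.
   Context: Participants $p,q,r,s$; labels $\ell$. A message is $(p,\ell,q)$; a queue $\mathcal M$ is a finite sequence of messages ($\emptyset$ empty, $\cdot$ concatenation) modulo the equivalence $\equiv$ allowing adjacent $(p,\ell,q),(r,\ell',s)$ to be swapped when $p\neq r$ or $q\neq s$. Global types: regular (finitely many distinct subterms) terms coinductively generated by $G::=\boxplus_{i\in I}pq!\ell_i;G_i\mid pq?\ell;G\mid\mathsf{End}$ ($I$ finite non-empty, pairwise distinct labels); an asynchronous type is $G\parallel\mathcal M$. Communications $\beta$: $pq!\ell$, $pq?\ell$, with $\mathrm{play}(pq!\ell)=\{p\}$, $\mathrm{play}(pq?\ell)=\{q\}$. $G$ is cyclic if its tree contains itself as a proper subtree. Balancing: $\vdash G\parallel\mathcal M$ holds if it is derivable by a possibly infinite derivation (coinductive interpretation) from: $\vdash\mathsf{End}\parallel\emptyset$; from $\vdash G\parallel\mathcal M$ infer $\vdash pq?\ell;G\parallel(p,\ell,q)\cdot\mathcal M$; from $\vdash G_i\parallel\mathcal M\cdot(p,\ell_i,q)$ for all $i\in I$ infer $\vdash\boxplus_{i\in I}pq!\ell_i;G_i\parallel\mathcal M$, provided $\mathcal M=\emptyset$ whenever $\boxplus_{i\in I}pq!\ell_i;G_i$ is cyclic. LTS of asynchronous types (inductive rules, queues modulo $\equiv$): (Ext-Out)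 $\boxplus_{i\in I}pq!\ell_i;G_i\parallel\mathcal M\xrightarrow{pq!\ell_k}G_k\parallel\mathcal M\cdot(p,\ell_k,q)$, $k\in I$; (Ext-In) $pq?\ell;G\parallel(p,\ell,q)\cdot\mathcal M\xrightarrow{pq?\ell}G\parallel\mathcal M$; (IComm-Out) if $G_i\parallel\mathcal M\cdot(p,\ell_i,q)\xrightarrow{\beta}G'_i\parallel\mathcal M'\cdot(p,\ell_i,q)$ for all $i\in I$ and $p\notin\mathrm{play}(\beta)$ then $\boxplus_{i\in I}pq!\ell_i;G_i\parallel\mathcal M\xrightarrow{\beta}\boxplus_{i\in I}pq!\ell_i;G'_i\parallel\mathcal M'$; (IComm-In) if $G\parallel\mathcal M\xrightarrow{\beta}G'\parallel\mathcal M'$ and $q\notin\mathrm{play}(\beta)$ then $pq?\ell;G\parallel(p,\ell,q)\cdot\mathcal M\xrightarrow{\beta}pq?\ell;G'\parallel(p,\ell,q)\cdot\mathcal M'$. -}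

module Defs where

open import Level using (Level)
open import Data.Nat using (ℕ; suc)
open import Data.Fin using (Fin)
open import Data.Product using (Σ; ∃; ∃-syntax; _×_; _,_)
open import Data.Sum using (_⊎_)
open import Data.List using (List; []; _∷_; _++_; [_])
open import Function.Definitions using (Injective)
open import Relation.Binary.PropositionalEquality using (_≡_)
open import Relation.Nullary using (¬_)

-- Everything is parametric in the set P of participants and the set L of labels.
module Async (P L : Set) where

  Msg : Set
  Msg = P × L × P          -- (p , ℓ , q) : message from p to q with label ℓ

  Queue : Set
  Queue = List Msg

  data _≈q_ : Queue → Queue → Set where
    q-refl  : ∀ {M} → M ≈q M
    q-sym   : ∀ {M N} → M ≈q N → N ≈q M
    q-trans : ∀ {M N K} → M ≈q N → N ≈q K → M ≈q K
    q-swap  : ∀ (xs ys : Queue) {p q r s : P} {l l' : L} →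
              (¬ p ≡ r ⊎ ¬ q ≡ s) →
              (xs ++ (p , l , q) ∷ (r , l' , s) ∷ ys) ≈q
              (xs ++ (r , l' , s) ∷ (p , l , q) ∷ ys)

  -- Regular global types, presented as rooted finite graphs.
  -- A choice ⊞_{i∈I} pq!ℓ_i;G_i has finite non-empty I = Fin (suc k)
  -- and pairwise distinct labels (ls injective).
  data Node (n : ℕ) : Set where
    end  : Node n
    send : (p q : P) (k : ℕ) (ls : Fin (suc k) → L)
           .(inj : Injective _≡_ _≡_ ls) (cs : Fin (suc k) → Fin n) → Node n
    recv : (p q : P) (l : L) (c : Fin n) → Node n

  -- A global type: a finite graph with a root; it denotes the (regular)
  -- tree obtained by unfolding the graph from the root.
  record GT : Set where
    constructor gt
    field
      size  : ℕ
      graph : Fin size → Node size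
      root  : Fin size
  open GT public

  _⟨_⟩ : (G : GT) → Fin (size G) → GT
  G ⟨ j ⟩ = gt (size G) (graph G) j

  node : (G : GT) → Node (size G)
  node G = graph G (root G)

  -- Tree equality of global types: bisimilarity of the unfoldings
  -- (greatest fixed point).  Branches of a choice are compared as a
  -- family indexed by I, i.e. up to reindexing of I.
  data NodeSim (R : GT → GT → Set) (G H : GT) :
       Node (size G) → Node (size H) → Set where
    end  : NodeSim R G H end end
    send : ∀ {p q k k' ls ls' cs cs'} .{inj : Injective _≡_ _≡_ ls} .{inj' : Injective _≡_ _≡_ ls'} →
           (∀ i → ∃[ j ] (ls i ≡ ls' j × R (G ⟨ cs i ⟩) (H ⟨ cs' j ⟩))) →
           (∀ j → ∃[ i ] (ls i ≡ ls' j × R (G ⟨ cs i ⟩) (H ⟨ cs' j ⟩))) →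
           NodeSim R G H (send p q k ls inj cs) (send p q k' ls' inj' cs')
    recv : ∀ {p q l c c'} → R (G ⟨ c ⟩) (H ⟨ c' ⟩) →
           NodeSim R G H (recv p q l c) (recv p q l c')

  IsBisim : (GT → GT → Set) → Set
  IsBisim R = ∀ G H → R G H → NodeSim R G H (node G) (node H)

  _≈_ : GT → GT → Set₁
  G ≈ H = Σ (GT → GT → Set) λ R → IsBisim R × R G H

  data Child : GT → GT → Set where
    c-send : ∀ {G p q k ls cs} .{inj : Injective _≡_ _≡_ ls} → node G ≡ send p q k ls inj cs →
             (i : Fin (suc k)) → Child G (G ⟨ cs i ⟩)
    c-recv : ∀ {G p q l c} → node G ≡ recv p q l c → Child G (G ⟨ c ⟩)

  data Reach : GT → GT → Set where
    here  : ∀ {G} → Reach G G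
    child : ∀ {G K H} → Child G K → Reach K H → Reach G H

  Cyclic : GT → Set₁
  Cyclic G = ∃[ K ] ∃[ H ] (Child G K × Reach K H × H ≈ G)

  -- Balancing  ⊢ G ∥ M : coinductive interpretation of the rules, i.e.
  -- (G , M) belongs to some relation that is backward closed under them.
  data BalF (R : GT → Queue → Set) (G : GT) : Node (size G) → Queue → Set₁ where
    b-end  : ∀ {M} → M ≈q [] → BalF R G end M
    b-recv : ∀ {p q l c M M'} → M ≈q ((p , l , q) ∷ M') → R (G ⟨ c ⟩) M' →
             BalF R G (recv p q l c) M
    b-send : ∀ {p q k ls cs M} .{inj : Injective _≡_ _≡_ ls} →
             (∀ i → R (G ⟨ cs i ⟩) (M ++ [ (p , ls i , q) ])) →
             (Cyclic G → M ≈q []) →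
             BalF R G (send p q k ls inj cs) M

  BalClosed : (GT → Queue → Set) → Set₁
  BalClosed R = ∀ G M → R G M → BalF R G (node G) M

  Bal : GT → Queue → Set₁
  Bal G M = Σ (GT → Queue → Set) λ R → BalClosed R × R G M

  data Comm : Set where
    _⟨_⟩!_ : P → L → P → Comm
    _⟨_⟩?_ : P → L → P → Comm

  -- play(β) is a singleton; this is its unique element.
  player : Comm → P
  player (p ⟨ _ ⟩! _) = p
  player (_ ⟨ _ ⟩? q) = q

  data Step : GT → Queue → Comm → GT → Queue → Set where
    ext-out   : ∀ {G p q k ls cs M M'} .{inj : Injective _≡_ _≡_ ls} → node G ≡ send p q k ls inj cs →
                (i : Fin (suc k)) → M' ≈q (M ++ [ (p , ls i , q) ]) →
                Step G M (p ⟨ ls i ⟩! q) (G ⟨ cs i ⟩) M'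
    ext-in    : ∀ {G p q l c M M'} → node G ≡ recv p q l c →
                M ≈q ((p , l , q) ∷ M') →
                Step G M (p ⟨ l ⟩? q) (G ⟨ c ⟩) M'
    icomm-out : ∀ {G G' p q k ls cs cs' M M' β} .{inj : Injective _≡_ _≡_ ls} .{inj' : Injective _≡_ _≡_ ls} →
                node G ≡ send p q k ls inj cs → node G' ≡ send p q k ls inj' cs' →
                (∀ i → Step (G ⟨ cs i ⟩) (M ++ [ (p , ls i , q) ]) β
                            (G' ⟨ cs' i ⟩) (M' ++ [ (p , ls i , q) ])) →
                ¬ p ≡ player β →
                Step G M β G' M'
    icomm-in  : ∀ {G G' p q l c c' M M₀ M' M₀' β} →
                node G ≡ recv p q l c → node G' ≡ recv p q l c' →
                M ≈q ((p , l , q) ∷ M₀) → M' ≈q ((p , l , q) ∷ M₀') →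
                Step (G ⟨ c ⟩) M₀ β (G' ⟨ c' ⟩) M₀' →
                ¬ q ≡ player β →
                Step G M β G' M'

{-# OPTIONS --safe #-}
module Submission where

open import Defs
open import Data.Nat using (ℕ; suc; _+_)
open import Data.Nat.Properties using (+-suc; +-assoc; +-identityʳ; +-cancelˡ-≡; +-cancelʳ-≡; suc-injective)
open import Data.Fin using (Fin)
open import Data.Product using (∃-syntax; _×_; _,_; proj₁; proj₂)
open import Data.Sum using (_⊎_; inj₁; inj₂)
open import Data.List using (List; []; _∷_; _++_; [_]; length)
open import Data.List.Properties using (length-++; ++-assoc)
open import Data.Empty using (⊥-elim)
open import Function.Definitions using (Injective)
open import Relation.Binary.PropositionalEquality using (_≡_; refl; sym; trans; cong; subst; subst₂; module ≡-Reasoning)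
open import Relation.Nullary using (¬_)

-- The heart of the proof is the side condition of the send rule: after a step,
-- a cyclic send node must again carry the empty queue.  Along any path from a
-- balanced G ∥ M, the queue length changes by +1 per send and −1 per receive,
-- and a balanced cyclic send node has an empty queue (a cyclic receive node need
-- not); hence |M| + #sends = #receives along every path from G to a cyclic send
-- node ("G ∥ M drains").  This counting
-- invariant is preserved by every step of the LTS, and at a cyclic send node
-- itself (the empty path) it says that the queue is empty.  The rest is
-- coinduction: balanced types, together with their one-step successors, form a
-- relation closed under the balancing rules.

module _ (P L : Set) where
  open Async P L

  Independent : Msg → Msg → Set
  Independent (p , _ , q) (r , _ , s) = ¬ p ≡ r ⊎ ¬ q ≡ s

  independent-sym : ∀ {x y} → Independent x y → Independent y x
  independent-sym (inj₁ p≢r) = inj₁ (λ r≡p → p≢r (sym r≡p))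
  independent-sym (inj₂ q≢s) = inj₂ (λ s≡q → q≢s (sym s≡q))

  independent-irrefl : ∀ {x} → ¬ Independent x x
  independent-irrefl (inj₁ p≢p) = p≢p refl
  independent-irrefl (inj₂ q≢q) = q≢q refl

  -- Extract x A R: x can be swapped to the front of A, leaving R behind.
  data Extract (x : Msg) : Queue → Queue → Set where
    here  : ∀ {A} → Extract x (x ∷ A) A
    there : ∀ {y A R} → Independent y x → Extract x A R → Extract x (y ∷ A) (y ∷ R)

  ExtractSim : Queue → Queue → Set
  ExtractSim A B = ∀ {x R} → Extract x A R → ∃[ R′ ] (Extract x B R′ × R ≈q R′)

  ∷-cong : ∀ {x A B} → A ≈q B → (x ∷ A) ≈q (x ∷ B)
  ∷-cong q-refl           = q-refl
  ∷-cong (q-sym e)        = q-sym (∷-cong e)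
  ∷-cong (q-trans e e′)   = q-trans (∷-cong e) (∷-cong e′)
  ∷-cong {x} (q-swap xs ys c) = q-swap (x ∷ xs) ys c

  ++-congʳ : ∀ {A B} K → A ≈q B → (A ++ K) ≈q (B ++ K)
  ++-congʳ K q-refl         = q-refl
  ++-congʳ K (q-sym e)      = q-sym (++-congʳ K e)
  ++-congʳ K (q-trans e e′) = q-trans (++-congʳ K e) (++-congʳ K e′)
  ++-congʳ K (q-swap xs ys {p} {q} {r} {s} {l} {l′} c) =
    subst₂ _≈q_ (sym (++-assoc xs ((p , l , q) ∷ (r , l′ , s) ∷ ys) K))
                (sym (++-assoc xs ((r , l′ , s) ∷ (p , l , q) ∷ ys) K))
                (q-swap xs (ys ++ K) c)

  length-cong : ∀ {A B} → A ≈q B → length A ≡ length B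
  length-cong q-refl         = refl
  length-cong (q-sym e)      = sym (length-cong e)
  length-cong (q-trans e e′) = trans (length-cong e) (length-cong e′)
  length-cong (q-swap xs ys {p} {q} {r} {s} {l} {l′} c) =
    trans (length-++ xs {(p , l , q) ∷ (r , l′ , s) ∷ ys})
          (sym (length-++ xs {(r , l′ , s) ∷ (p , l , q) ∷ ys}))

  length-zero : ∀ {A} → length A ≡ 0 → A ≈q []
  length-zero {[]} _ = q-refl

  length-snoc-+ : ∀ A {x : Msg} n → length (A ++ [ x ]) + n ≡ length A + suc n
  length-snoc-+ A n = trans (cong (_+ n) (length-++ A)) (+-assoc (length A) 1 n)

  extractSim-trans : ∀ {A B C} → ExtractSim A B → ExtractSim B C → ExtractSim A C
  extractSim-trans f g ex with f ex
  ... | R₁ , ex₁ , e₁ with g ex₁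
  ... | R₂ , ex₂ , e₂ = R₂ , ex₂ , q-trans e₁ e₂

  extractSim-swap : ∀ xs {a b ys} → Independent a b →
                    ExtractSim (xs ++ a ∷ b ∷ ys) (xs ++ b ∷ a ∷ ys)
  extractSim-swap [] {a} {b} {ys} iab here = b ∷ ys , there (independent-sym {a} {b} iab) here , q-refl
  extractSim-swap [] iab (there _ here) = _ , here , q-refl
  extractSim-swap [] iab (there i (there j ex)) = _ , there j (there i ex) , q-swap [] _ iab
  extractSim-swap (_ ∷ xs) {ys = ys} iab here = _ , here , q-swap xs ys iab
  extractSim-swap (_ ∷ xs) iab (there i ex) with extractSim-swap xs iab ex
  ... | R′ , ex′ , e = _ , there i ex′ , ∷-cong e

  ≈q⇒extractSim : ∀ {A B} → A ≈q B → ExtractSim A B × ExtractSim B A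
  ≈q⇒extractSim q-refl = (λ ex → _ , ex , q-refl) , (λ ex → _ , ex , q-refl)
  ≈q⇒extractSim (q-sym e) = proj₂ (≈q⇒extractSim e) , proj₁ (≈q⇒extractSim e)
  ≈q⇒extractSim (q-trans e e′) =
    extractSim-trans (proj₁ (≈q⇒extractSim e)) (proj₁ (≈q⇒extractSim e′)) ,
    extractSim-trans (proj₂ (≈q⇒extractSim e′)) (proj₂ (≈q⇒extractSim e))
  ≈q⇒extractSim (q-swap xs ys {p} {q} {r} {s} {l} {l′} c) =
    extractSim-swap xs c , extractSim-swap xs (independent-sym {p , l , q} {r , l′ , s} c)

  ∷-cancel : ∀ {x A B} → (x ∷ A) ≈q (x ∷ B) → A ≈q B
  ∷-cancel e with proj₁ (≈q⇒extractSim e) here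
  ... | _ , here , e′ = e′
  ... | _ , there {y} i _ , _ = ⊥-elim (independent-irrefl {y} i)

  data Act : Set where
    snd rcv : Act

  #snd #rcv : List Act → ℕ
  #snd []        = 0
  #snd (snd ∷ w) = suc (#snd w)
  #snd (rcv ∷ w) = #snd w
  #rcv []        = 0
  #rcv (snd ∷ w) = #rcv w
  #rcv (rcv ∷ w) = suc (#rcv w)

  #snd-++ : ∀ w v → #snd (w ++ v) ≡ #snd w + #snd v
  #snd-++ []        v = refl
  #snd-++ (snd ∷ w) v = cong suc (#snd-++ w v)
  #snd-++ (rcv ∷ w) v = #snd-++ w v

  #rcv-++ : ∀ w v → #rcv (w ++ v) ≡ #rcv w + #rcv v
  #rcv-++ []        v = refl
  #rcv-++ (snd ∷ w) v = #rcv-++ w v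
  #rcv-++ (rcv ∷ w) v = cong suc (#rcv-++ w v)

  data Path : GT → GT → List Act → Set where
    []    : ∀ {G} → Path G G []
    sstep : ∀ {G H w p q k ls cs} .{inj : Injective _≡_ _≡_ ls} → node G ≡ send p q k ls inj cs →
            (i : Fin (suc k)) → Path (G ⟨ cs i ⟩) H w → Path G H (snd ∷ w)
    rstep : ∀ {G H w p q l c} → node G ≡ recv p q l c → Path (G ⟨ c ⟩) H w → Path G H (rcv ∷ w)

  _++ᵖ_ : ∀ {G H K w v} → Path G H w → Path H K v → Path G K (w ++ v)
  []            ++ᵖ π′ = π′
  sstep e i π   ++ᵖ π′ = sstep e i (π ++ᵖ π′)
  rstep e π     ++ᵖ π′ = rstep e (π ++ᵖ π′)

  path⇒reach : ∀ {G H w} → Path G H w → Reach G H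
  path⇒reach []            = here
  path⇒reach (sstep e i π) = child (c-send e i) (path⇒reach π)
  path⇒reach (rstep e π)   = child (c-recv e) (path⇒reach π)

  reach⇒path : ∀ {G H} → Reach G H → ∃[ w ] Path G H w
  reach⇒path here = [] , []
  reach⇒path (child (c-send e i) r) with reach⇒path r
  ... | w , π = snd ∷ w , sstep e i π
  reach⇒path (child (c-recv e) r) with reach⇒path r
  ... | w , π = rcv ∷ w , rstep e π

  module _ (S : GT → GT → Set) (isBisim : IsBisim S) where
    private
      sim-sstep : ∀ {G H} {a : Node (size G)} {b : Node (size H)} → node G ≡ a → NodeSim S G H a b →
                  ∀ {p q k ls cs} .{inj : Injective _≡_ _≡_ ls} → b ≡ send p q k ls inj cs → (i : Fin (suc k)) →
                  ∃[ G′ ] (S G′ (H ⟨ cs i ⟩) × (∀ {K w} → Path G′ K w → Path G K (snd ∷ w)))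
      sim-sstep eG (send _ back) refl i with back i
      ... | j , _ , s = _ , s , sstep eG j

      sim-rstep : ∀ {G H} {a : Node (size G)} {b : Node (size H)} → node G ≡ a → NodeSim S G H a b →
                  ∀ {p q l c} → b ≡ recv p q l c →
                  ∃[ G′ ] (S G′ (H ⟨ c ⟩) × (∀ {K w} → Path G′ K w → Path G K (rcv ∷ w)))
      sim-rstep eG (recv s) refl = _ , s , rstep eG

    path-transport-by : ∀ {G H H′ w} → S G H → Path H H′ w → ∃[ G′ ] (Path G G′ w × S G′ H′)
    path-transport-by s [] = _ , [] , s
    path-transport-by {G} {H} s (sstep e i π) with sim-sstep refl (isBisim G H s) e i
    ... | _ , s′ , extend with path-transport-by s′ π
    ... | G′ , π′ , s″ = G′ , extend π′ , s″
    path-transport-by {G} {H} s (rstep e π) with sim-rstep refl (isBisim G H s) e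
    ... | _ , s′ , extend with path-transport-by s′ π
    ... | G′ , π′ , s″ = G′ , extend π′ , s″

  path-transport : ∀ {G H H′ w} → G ≈ H → Path H H′ w → ∃[ G′ ] (Path G G′ w × G′ ≈ H′)
  path-transport (S , isBisim , s) π with path-transport-by S isBisim s π
  ... | G′ , π′ , s′ = G′ , π′ , S , isBisim , s′

  Loop : GT → List Act → Set₁
  Loop Z v = ∃[ Z′ ] (Path Z Z′ (snd ∷ v) × Z′ ≈ Z)

  loop-at-end : ∀ {Z v} (ℓ : Loop Z v) → Loop (proj₁ ℓ) v
  loop-at-end (_ , π , Z′≈Z) = path-transport Z′≈Z π

  cyclic-send⇒loop : ∀ {G p q k ls cs} .{inj : Injective _≡_ _≡_ ls} → node G ≡ send p q k ls inj cs →
                     Cyclic G → ∃[ v ] Loop G v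
  cyclic-send⇒loop _ (_ , H , c-send e i , r , H≈G) with reach⇒path r
  ... | v , π = v , H , sstep e i π , H≈G
  cyclic-send⇒loop eG (_ , _ , c-recv e , _) with trans (sym eG) e
  ... | ()

  Drains : GT → Queue → Set₁
  Drains G M = ∀ {Z w v} → Path G Z w → Loop Z v → length M + #snd w ≡ #rcv w

  drains-resp-≈q : ∀ {G M N} → M ≈q N → Drains G M → Drains G N
  drains-resp-≈q M≈N d π ℓ = trans (cong (_+ _) (sym (length-cong M≈N))) (d π ℓ)

  drains-send-child : ∀ {G M p q k ls cs} .{inj : Injective _≡_ _≡_ ls} → node G ≡ send p q k ls inj cs →
                      Drains G M → ∀ i → Drains (G ⟨ cs i ⟩) (M ++ [ (p , ls i , q) ])
  drains-send-child {M = M} e d i π ℓ = trans (length-snoc-+ M _) (d (sstep e i π) ℓ)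

  drains-recv-child : ∀ {G M p q l c} → node G ≡ recv p q l c →
                      Drains G ((p , l , q) ∷ M) → Drains (G ⟨ c ⟩) M
  drains-recv-child e d π ℓ = suc-injective (d (rstep e π) ℓ)

  drains-recv : ∀ {G M p q l c} → node G ≡ recv p q l c →
                Drains (G ⟨ c ⟩) M → Drains G ((p , l , q) ∷ M)
  drains-recv e d (rstep e′ π) ℓ with trans (sym e) e′
  ... | refl = cong suc (d π ℓ)
  drains-recv e d [] (_ , sstep e′ _ _ , _) with trans (sym e) e′
  ... | ()
  drains-recv e d (sstep e′ _ _) ℓ with trans (sym e) e′
  ... | ()

  -- Compare the counts along π with those along π followed once around the loop.
  loop-balanced : ∀ {G M Z w v} → Drains G M → Path G Z w → Loop Z v → #rcv v ≡ suc (#snd v)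
  loop-balanced {M = M} {w = w} {v} d π ℓ@(_ , π′ , _) = +-cancelˡ-≡ (#rcv w) _ _ (begin
    #rcv w + #rcv v                        ≡⟨ sym (#rcv-++ w (snd ∷ v)) ⟩
    #rcv (w ++ snd ∷ v)                    ≡⟨ sym (d (π ++ᵖ π′) (loop-at-end ℓ)) ⟩
    length M + #snd (w ++ snd ∷ v)         ≡⟨ cong (length M +_) (#snd-++ w (snd ∷ v)) ⟩
    length M + (#snd w + suc (#snd v))     ≡⟨ sym (+-assoc (length M) (#snd w) _) ⟩
    length M + #snd w + suc (#snd v)       ≡⟨ cong (_+ suc (#snd v)) (d π ℓ) ⟩
    #rcv w + suc (#snd v)                  ∎)
    where open ≡-Reasoning

  drains-send : ∀ {G M p q k ls cs} .{inj : Injective _≡_ _≡_ ls} → node G ≡ send p q k ls inj cs →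
                (∀ i → Drains (G ⟨ cs i ⟩) (M ++ [ (p , ls i , q) ])) → Drains G M
  drains-send {M = M} e ds (sstep e′ i π) ℓ with trans (sym e) e′
  ... | refl = trans (sym (length-snoc-+ M _)) (ds i π ℓ)
  drains-send {M = M} e ds {v = v} [] ℓ@(Z′ , sstep e′ i π , _) with trans (sym e) e′
  ... | refl = trans (+-identityʳ (length M)) (+-cancelʳ-≡ (suc (#snd v)) (length M) 0 (begin
    length M + suc (#snd v)       ≡⟨ sym (length-snoc-+ M (#snd v)) ⟩
    length (M ++ [ _ ]) + #snd v  ≡⟨ ds i π ℓ′ ⟩
    #rcv v                        ≡⟨ loop-balanced {M = M ++ _} (ds i) π ℓ′ ⟩
    suc (#snd v)                  ∎))
    where
    ℓ′ : Loop Z′ v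
    ℓ′ = loop-at-end ℓ
    open ≡-Reasoning
  drains-send e ds (rstep e′ _) ℓ with trans (sym e) e′
  ... | ()

  drains-step : ∀ {G M β G′ M′} → Drains G M → Step G M β G′ M′ → Drains G′ M′
  drains-step {M = M} d (ext-out e i M′≈) = drains-resp-≈q (q-sym M′≈) (drains-send-child {M = M} e d i)
  drains-step d (ext-in {M' = M′} e M≈) = drains-recv-child {M = M′} e (drains-resp-≈q M≈ d)
  drains-step {M = M} {M′ = M′} d (icomm-out e e′ steps _) =
    drains-send {M = M′} e′ (λ i → drains-step (drains-send-child {M = M} e d i) (steps i))
  drains-step d (icomm-in {M₀ = M₀} {M₀' = M₀′} e e′ M≈ M′≈ step _) =
    drains-resp-≈q (q-sym M′≈)
      (drains-recv {M = M₀′} e′ (drains-step (drains-recv-child {M = M₀} e (drains-resp-≈q M≈ d)) step))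

  drains-cyclic-send : ∀ {G M p q k ls cs} .{inj : Injective _≡_ _≡_ ls} → node G ≡ send p q k ls inj cs →
                       Drains G M → Cyclic G → M ≈q []
  drains-cyclic-send {M = M} e d cyc with cyclic-send⇒loop e cyc
  ... | _ , ℓ = length-zero (trans (sym (+-identityʳ (length M))) (d [] ℓ))

  module Closure (R : GT → Queue → Set) (closed : BalClosed R) where
    unfold : ∀ {G M n} → R G M → node G ≡ n → BalF R G n M
    unfold {G} {M} r e = subst (λ n → BalF R G n M) e (closed G M r)

    closed-path : ∀ {G H M w} → R G M → Path G H w →
                  ∃[ N ] (R H N × length N + #rcv w ≡ length M + #snd w)
    closed-path r [] = _ , r , refl
    closed-path {M = M} r (sstep e i π) with unfold r e
    ... | b-send children _ with closed-path (children i) π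
    ... | N , rN , eq = N , rN , trans eq (length-snoc-+ M _)
    closed-path {M = M} r (rstep {w = w} e π) with unfold r e
    ... | b-recv M≈ r₁ with closed-path r₁ π
    ... | N , rN , eq = N , rN ,
      trans (+-suc (length N) (#rcv w)) (trans (cong suc eq) (cong (_+ #snd w) (sym (length-cong M≈))))

    closed-loop-empty : ∀ {Z N v} → R Z N → Loop Z v → length N ≡ 0
    closed-loop-empty r (Z′ , sstep e i π , Z′≈Z) with unfold r e
    ... | b-send _ cyclic = length-cong (cyclic (_ , Z′ , c-send e i , path⇒reach π , Z′≈Z))

    closed-drains : ∀ {G M} → R G M → Drains G M
    closed-drains r π ℓ with closed-path r π
    ... | N , rN , eq = trans (sym eq) (cong (_+ _) (closed-loop-empty rN ℓ))

    R≈q : GT → Queue → Set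
    R≈q G M = ∃[ N ] (R G N × N ≈q M)

    R≈q-resp : ∀ {G M M′} → R≈q G M → M ≈q M′ → R≈q G M′
    R≈q-resp (N , r , N≈M) M≈M′ = N , r , q-trans N≈M M≈M′

    R≈q-send-child : ∀ {G M p q k ls cs} .{inj : Injective _≡_ _≡_ ls} → R≈q G M →
                     node G ≡ send p q k ls inj cs → ∀ i → R≈q (G ⟨ cs i ⟩) (M ++ [ (p , ls i , q) ])
    R≈q-send-child (N , r , N≈M) e i with unfold r e
    ... | b-send children _ = _ , children i , ++-congʳ _ N≈M

    R≈q-recv-child : ∀ {G M M′ p q l c} → R≈q G M → node G ≡ recv p q l c →
                     M ≈q ((p , l , q) ∷ M′) → R≈q (G ⟨ c ⟩) M′
    R≈q-recv-child (N , r , N≈M) e M≈ with unfold r e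
    ... | b-recv N≈ r₁ = _ , r₁ , ∷-cancel (q-trans (q-sym N≈) (q-trans N≈M M≈))

    R≈q-drains : ∀ {G M} → R≈q G M → Drains G M
    R≈q-drains (_ , r , N≈M) = drains-resp-≈q N≈M (closed-drains r)

    Successor : GT → Queue → Set
    Successor G M = R≈q G M ⊎ ∃[ G₀ ] ∃[ M₀ ] ∃[ β ] (R≈q G₀ M₀ × Step G₀ M₀ β G M)

    R≈q-closed : ∀ G M → R≈q G M → BalF Successor G (node G) M
    R≈q-closed G M (N , r , N≈M) with node G | closed G N r
    ... | _ | b-end N≈[]           = b-end (q-trans (q-sym N≈M) N≈[])
    ... | _ | b-recv N≈ r₁         = b-recv (q-trans (q-sym N≈M) N≈) (inj₁ (_ , r₁ , q-refl))
    ... | _ | b-send children cyclic =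
      b-send (λ i → inj₁ (_ , children i , ++-congʳ _ N≈M)) (λ c → q-trans (q-sym N≈M) (cyclic c))

    step-closed : ∀ {G₀ M₀ β G M} → R≈q G₀ M₀ → Step G₀ M₀ β G M → BalF Successor G (node G) M
    step-closed b (ext-out e i M≈) = R≈q-closed _ _ (R≈q-resp (R≈q-send-child b e i) (q-sym M≈))
    step-closed b (ext-in e M≈) = R≈q-closed _ _ (R≈q-recv-child b e M≈)
    step-closed {G = G} {M} b s@(icomm-out e e′ steps _) =
      subst (λ n → BalF Successor G n M) (sym e′)
        (b-send (λ i → inj₂ (_ , _ , _ , R≈q-send-child b e i , steps i))
                (drains-cyclic-send e′ (drains-step (R≈q-drains b) s)))
    step-closed {G = G} {M} b (icomm-in e e′ M≈ M′≈ step _) =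
      subst (λ n → BalF Successor G n M) (sym e′)
        (b-recv M′≈ (inj₂ (_ , _ , _ , R≈q-recv-child b e M≈ , step)))

    successor-closed : BalClosed Successor
    successor-closed G M (inj₁ b)                 = R≈q-closed G M b
    successor-closed G M (inj₂ (_ , _ , _ , b , s)) = step-closed b s

lemma3p12 : (P L : Set) → let open Async P L in
    ∀ {G M β G' M'} → Bal G M → Step G M β G' M' → Bal G' M'
lemma3p12 P L (R , closed , r) s =
  Successor , successor-closed , inj₂ (_ , _ , _ , (_ , r , Async.q-refl) , s)
  where open Closure P L R closed
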